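{- For atomic designs $D,E$ of the same polarity, let $D\preceq E$ iff $\{D\}^\perp\subseteq\{E\}^\perp$. Then: (1) $\preceq$ is a preorder; (2) $P\le Q$ implies $P\preceq Q$ for any atomic positive designs $P,Q$; (3) if $\mathbf{X},\mathbf{Y}$ are sets of atomic designs of the same polarity with $\mathbf{X}\subseteq\mathbf{Y}$, then $\bigwedge\mathbf{Y}\preceq\bigwedge\mathbf{X}$.
   Context: Fix a signature (names $A$ with arities $\mathsf{ar}$) and a countable set of variables. Designs are possibly infinite terms coinductively generated by: positive $P ::= \Omega \mid \bigwedge\{S_i : i\in I\}$ ($I$ arbitrary); predesigns $S ::= N_0\,|\,\overline{a}\langle N_1,\dots,N_n\rangle$ ($\mathsf{ar}(a)=n$); negative $N ::= x \mid \sum a(\vec x).P_a$ (one component $a(\vec x).P_a$ for each $a\in A$, $\vec x$ distinct bound variables of length $\mathsf{ar}(a)$); designs are taken up to $\alpha$-renaming and set-like treatment of conjunctions, $\bigwedge\{S\}=S$, $\maltese:=\bigwedge\emptyset$. A cut is a predesign $(\sum a(\vec x).P_a)\,|\,\overline b\langle\vec N\rangle$. Reduction: $P\rightsquigarrow Q$ iff $P$ has a cut conjunct $(\sum a(\vec x).P_a)\,|\,\overline b\langle\vec N\rangle$ and $Q=P_b[\vec N/\vec x]$. Normal form (corecursive): $[\![P]\!]=\Omega$ if some reduction sequence from $P$ is infinite or ends in $\Omega$; otherwise $[\![P]\!]$ is the conjunction of all $x\,|\,\overline a\langle[\![\vec N]\!]\rangle$ with $x|\overline a\langle\vec N\rangle$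 a conjunct of some $Q$, $P\rightsquigarrow^*Q$; $[\![\sum a(\vec x).P_a]\!]=\sum a(\vec x).[\![P_a]\!]$, $[\![x]\!]=x$. A design is standard if it is $\neq\Omega$ and generated by the restricted grammar $P::=\Omega\mid\bigwedge\{S_i\}$, $S::=x\,|\,\overline a\langle N_1,\dots,N_n\rangle$, $N::=\sum a(\vec x).P_a$ (no cuts, no bare variables as negative subdesigns). A positive design is atomic if standard with free variables among a fixed variable $x_0$; a negative design is atomic if standard and closed. Atomic $P,N$ are orthogonal, $P\perp N$, iff $[\![P[N/x_0]]\!]=\maltese$. For a set $\mathbf{X}$ of atomic designs of one polarity, $\mathbf{X}^\perp$ is the set of atomic designs of the opposite polarity orthogonal to all members of $\mathbf{X}$. Order: $P\le Q$ iff $P=\Omega$ or both are conjunctions and every conjunct of $Q$ is a conjunct of $P$. Conjunction of sets: for positive designs, $\bigwedge\mathbf{X}=\maltese$ if $\mathbf{X}=\emptyset$, $\Omega$ if $\Omega\in\mathbf{X}$, otherwise the conjunction of all conjuncts of members of $\mathbf{X}$; for a set $\mathbf{X}$ of negative designs of the form $\sum a(\vec x).P_a$ (bound variables chosen uniformly), $\bigwedge\mathbf{X}:=\sum a(\vec x).\bigwedge\{P_a : \sum a(\vec x).P_a\in\mathbf{X}\}$. -}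

module Defs where

-- Possibly infinite terms are represented *coalgebraically*: a design is a
-- state of a coalgebra  out : St → NegF St  unfolding one layer of syntax
-- at a time.  Variables are de Bruijn indices (this realises "up to
-- alpha-renaming"); equality of designs is bisimilarity (_≈P_, _≈N_),
-- in which conjunctions are compared as *sets* of conjuncts (this realises
-- the "set-like treatment of conjunctions").

open import Data.Nat using (ℕ; zero; suc; _+_)
open import Data.Fin using (Fin)
import Data.Fin as Fin
open import Data.Product using (Σ; ∃; _×_; _,_; proj₁; proj₂)
open import Data.Sum using (_⊎_; inj₁; inj₂)
open import Data.Unit using (⊤; tt)
open import Data.Unit.Polymorphic using () renaming (⊤ to ⊤₁)
open import Data.Empty.Polymorphic using () renaming (⊥ to ⊥₁)
open import Data.Empty using (⊥)
open import Relation.Nullary using (¬_)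
open import Relation.Binary.PropositionalEquality using (_≡_; _≢_)
open import Relation.Binary.Construct.Closure.ReflexiveTransitive using (Star)

record Signature : Set₁ where
  field
    Name : Set
    ar   : Name → ℕ

module Designs (Sig : Signature) where
  open Signature Sig public

  -- One layer of syntax over a set X of (states standing for) negative
  -- subdesigns.  Under a(x₁…xₙ) the bound variables are the de Bruijn
  -- indices 0…n-1 and index n+j refers to the outer variable j.

  record PreF (X : Set) : Set where
    constructor _∣_⟨_⟩
    field
      head : X
      name : Name
      args : Fin (ar name) → X
  open PreF public

  data PosF (X : Set) : Set₁ where
    Ω : PosF X
    ⋀ : (I : Set) → (I → PreF X) → PosF X

  data NegF (X : Set) : Set₁ where
    var : ℕ → NegF X
    sum : ((a : Name) → PosF X) → NegF X

  PreF-map : ∀ {X Y} → (X → Y) → PreF X → PreF Y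
  PreF-map h (n ∣ a ⟨ Ns ⟩) = h n ∣ a ⟨ (λ k → h (Ns k)) ⟩

  PosF-map : ∀ {X Y} → (X → Y) → PosF X → PosF Y
  PosF-map h Ω       = Ω
  PosF-map h (⋀ I S) = ⋀ I (λ i → PreF-map h (S i))

  NegF-map : ∀ {X Y} → (X → Y) → NegF X → NegF Y
  NegF-map h (var x) = var x
  NegF-map h (sum f) = sum (λ a → PosF-map h (f a))

  record Coalg : Set₁ where
    field
      St  : Set
      out : St → NegF St
  open Coalg public

  record Pos : Set₁ where
    constructor mkPos
    field
      coalg : Coalg
      root  : PosF (St coalg)
  open Pos public

  record Neg : Set₁ where
    constructor mkNeg
    field
      coalgN : Coalg
      rootN  : St coalgN
  open Neg public

  ✠ : Pos
  ✠ = mkPos (record { St = ⊥ ; out = λ () }) (⋀ ⊥ (λ ()))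

  data PreRel {X Y : Set} (R : X → Y → Set) : PreF X → PreF Y → Set where
    pre-rel : ∀ {n m a} {Ns : Fin (ar a) → X} {Ms : Fin (ar a) → Y} →
              R n m → (∀ k → R (Ns k) (Ms k)) →
              PreRel R (n ∣ a ⟨ Ns ⟩) (m ∣ a ⟨ Ms ⟩)

  PosRel : {X Y : Set} (R : X → Y → Set) → PosF X → PosF Y → Set
  PosRel R Ω       Ω       = ⊤
  PosRel R Ω       (⋀ _ _) = ⊥
  PosRel R (⋀ _ _) Ω       = ⊥
  PosRel R (⋀ I S) (⋀ J T) =
    (∀ i → ∃ λ j → PreRel R (S i) (T j)) × (∀ j → ∃ λ i → PreRel R (S i) (T j))

  NegRel : {X Y : Set} (R : X → Y → Set) → NegF X → NegF Y → Set
  NegRel R (var x) (var y) = x ≡ y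
  NegRel R (var _) (sum _) = ⊥
  NegRel R (sum _) (var _) = ⊥
  NegRel R (sum f) (sum g) = ∀ a → PosRel R (f a) (g a)

  IsBisim : (C D : Coalg) → (St C → St D → Set) → Set
  IsBisim C D R = ∀ x y → R x y → NegRel R (out C x) (out D y)

  _≈P_ : Pos → Pos → Set₁
  P ≈P Q = Σ (St (coalg P) → St (coalg Q) → Set) λ R →
             IsBisim (coalg P) (coalg Q) R × PosRel R (root P) (root Q)

  _≈N_ : Neg → Neg → Set₁
  N ≈N M = Σ (St (coalgN N) → St (coalgN M) → Set) λ R →
             IsBisim (coalgN N) (coalgN M) R × R (rootN N) (rootN M)

  -- Substitution (as a new coalgebra; no recursion needed).
  -- States:  sub x k      = x, under k binders, with the pending substitution
  --          shift x m k  = x with every variable ≥ m incremented by k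

  data SubSt (X : Set) : Set where
    sub   : X → ℕ → SubSt X
    shift : X → ℕ → ℕ → SubSt X

  -- variable y under k binders: bound (inj₁ y) or free outer index (inj₂ (y-k))
  bnd : ℕ → ℕ → ℕ ⊎ ℕ
  bnd zero    y       = inj₂ y
  bnd (suc k) zero    = inj₁ zero
  bnd (suc k) (suc y) with bnd k y
  ... | inj₁ z = inj₁ (suc z)
  ... | inj₂ j = inj₂ j

  -- outer index j: substituted (inj₁ (σ j)) if j < n, else inj₂ (j - n)
  ext : ∀ {Z : Set} (n : ℕ) → (Fin n → Z) → ℕ → Z ⊎ ℕ
  ext zero    σ j       = inj₂ j
  ext (suc n) σ zero    = inj₁ (σ Fin.zero)
  ext (suc n) σ (suc j) = ext n (λ i → σ (Fin.suc i)) j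

  shiftVar : ℕ → ℕ → ℕ → ℕ
  shiftVar zero    k y       = k + y
  shiftVar (suc m) k zero    = zero
  shiftVar (suc m) k (suc y) = suc (shiftVar m k y)

  module _ (C : Coalg) where
    outShift : St C → ℕ → ℕ → NegF (SubSt (St C))
    outShift x m k with out C x
    ... | var y = var (shiftVar m k y)
    ... | sum f = sum (λ a → PosF-map (λ x′ → shift x′ (ar a + m) k) (f a))

    -- [σ₀,…,σₙ₋₁ / x₁,…,xₙ] : outer index i < n ↦ σᵢ, outer index n+j ↦ j
    outSub : (n : ℕ) → (Fin n → St C) → St C → ℕ → NegF (SubSt (St C))
    outSub n σ x k with out C x
    ... | sum f = sum (λ a → PosF-map (λ x′ → sub x′ (ar a + k)) (f a))
    ... | var y with bnd k y
    ...   | inj₁ z = var z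
    ...   | inj₂ j with ext n σ j
    ...     | inj₁ s  = outShift s zero k
    ...     | inj₂ j′ = var (k + j′)

    substC : (n : ℕ) → (Fin n → St C) → Coalg
    substC n σ = record
      { St  = SubSt (St C)
      ; out = λ { (sub x k) → outSub n σ x k ; (shift x m k) → outShift x m k } }

  substPos : (C : Coalg) (n : ℕ) → (Fin n → St C) → PosF (St C) → Pos
  substPos C n σ p = mkPos (substC C n σ) (PosF-map (λ x → sub x zero) p)

  _⊕_ : Coalg → Coalg → Coalg
  C ⊕ D = record
    { St  = St C ⊎ St D
    ; out = λ { (inj₁ x) → NegF-map inj₁ (out C x) ; (inj₂ y) → NegF-map inj₂ (out D y) } }

  -- P[N/x₀]   (x₀ is the de Bruijn index 0)
  _[_/x₀] : Pos → Neg → Pos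
  P [ N /x₀] =
    substPos (coalg P ⊕ coalgN N) 1 (λ _ → inj₂ (rootN N)) (PosF-map inj₁ (root P))

  data _⇝_ : Pos → Pos → Set₁ where
    step : ∀ {C I} {S : I → PreF (St C)} (i : I) {f} →
           out C (head (S i)) ≡ sum f →
           mkPos C (⋀ I S) ⇝ substPos C (ar (name (S i))) (args (S i)) (f (name (S i)))

  _⇝*_ : Pos → Pos → Set₁
  _⇝*_ = Star _⇝_

  Diverges : Pos → Set₁
  Diverges P = Σ (ℕ → Pos) λ s → (s zero ≡ P) × (∀ n → s n ⇝ s (suc n))

  ReachesΩ : Pos → Set₁
  ReachesΩ P = Σ Pos λ Q → (P ⇝* Q) × (root Q ≡ Ω)

  HasHeadVarConjunct : Pos → Set₁
  HasHeadVarConjunct P =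
    Σ Set λ I → Σ (I → PreF (St (coalg P))) λ S → (root P ≡ ⋀ I S) ×
      Σ I λ i → Σ ℕ λ x → out (coalg P) (head (S i)) ≡ var x

  -- "[[P]] = ✠", unfolding the corecursive definition of the normal form:
  -- [[P]] = Ω (≠ ✠) iff some reduction sequence is infinite or ends in Ω;
  -- otherwise [[P]] is the conjunction of the x|ā⟨[[N⃗]]⟩ over head-variable
  -- conjuncts x|ā⟨N⃗⟩ of reducts Q of P, which is ⋀∅ = ✠ exactly when there
  -- are no such conjuncts.
  NormalFormIs✠ : Pos → Set₁
  NormalFormIs✠ P =
    ¬ Diverges P × ¬ ReachesΩ P × (∀ Q → P ⇝* Q → ¬ HasHeadVarConjunct Q)

  -- Standard designs: coinductively generated by the restricted grammar
  --   P ::= Ω | ⋀{Sᵢ},  S ::= x | ā⟨N⃗⟩,  N ::= Σ a(x⃗).Pₐ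
  -- (greatest fixed point = existence of an invariant set "Good" of states)

  StdPosF : (C : Coalg) → (St C → Set) → PosF (St C) → Set₁
  StdPosF C Good Ω       = ⊤₁
  StdPosF C Good (⋀ I S) =
    ∀ i → (Σ ℕ λ x → out C (head (S i)) ≡ var x) × (∀ k → Good (args (S i) k))

  StdNegF : (C : Coalg) → (St C → Set) → NegF (St C) → Set₁
  StdNegF C Good (var _) = ⊥₁
  StdNegF C Good (sum f) = ∀ a → StdPosF C Good (f a)

  StdInvariant : (C : Coalg) → (St C → Set) → Set₁
  StdInvariant C Good = ∀ s → Good s → StdNegF C Good (out C s)

  StandardP : Pos → Set₁
  StandardP P = (root P ≢ Ω) ×
    Σ (St (coalg P) → Set) λ Good →
      StdInvariant (coalg P) Good × StdPosF (coalg P) Good (root P)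

  StandardN : Neg → Set₁
  StandardN N =
    Σ (St (coalgN N) → Set) λ Good →
      StdInvariant (coalgN N) Good × Good (rootN N)

  -- Free occurrences of a variable (always at finite depth: inductive)
  module _ (C : Coalg) where
    mutual
      data OccP (x : ℕ) : PosF (St C) → Set₁ where
        in-⋀ : ∀ {I} {S : I → PreF (St C)} (i : I) → OccS x (S i) → OccP x (⋀ I S)

      data OccS (x : ℕ) : PreF (St C) → Set₁ where
        in-head : ∀ {p} → OccN x (head p) → OccS x p
        in-arg  : ∀ {p} (k : Fin (ar (name p))) → OccN x (args p k) → OccS x p

      data OccN (x : ℕ) (s : St C) : Set₁ where
        here   : out C s ≡ var x → OccN x s
        in-sum : ∀ {f} → out C s ≡ sum f → (a : Name) →
                 OccP (ar a + x) (f a) → OccN x s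

  AtomicP : Pos → Set₁
  AtomicP P = StandardP P × (∀ x → OccP (coalg P) x (root P) → x ≡ zero)

  AtomicN : Neg → Set₁
  AtomicN N = StandardN N × (∀ x → ¬ OccN (coalgN N) x (rootN N))

  _⟂_ : Pos → Neg → Set₁
  P ⟂ N = NormalFormIs✠ (P [ N /x₀])

  _⪯P_ : Pos → Pos → Set₁
  P ⪯P Q = ∀ N → AtomicN N → P ⟂ N → Q ⟂ N

  _⪯N_ : Neg → Neg → Set₁
  N ⪯N M = ∀ P → AtomicP P → P ⟂ N → P ⟂ M

  _≤P_ : Pos → Pos → Set₁
  P ≤P Q = (root P ≡ Ω) ⊎
    (Σ Set λ I → Σ (I → PreF (St (coalg P))) λ S → (root P ≡ ⋀ I S) ×
     Σ Set λ J → Σ (J → PreF (St (coalg Q))) λ T → (root Q ≡ ⋀ J T) ×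
     Σ (St (coalg P) → St (coalg Q) → Set) λ R →
       IsBisim (coalg P) (coalg Q) R × (∀ j → ∃ λ i → PreRel R (S i) (T j)))

  -- Sets of designs are families indexed by a type J : Set (membership
  -- and inclusion up to equality of designs).
  _⊆P_ : ∀ {J K : Set} → (J → Pos) → (K → Pos) → Set₁
  X ⊆P Y = ∀ j → ∃ λ k → X j ≈P Y k

  _⊆N_ : ∀ {J K : Set} → (J → Neg) → (K → Neg) → Set₁
  X ⊆N Y = ∀ j → ∃ λ k → X j ≈N Y k

  ΣCoalg : {J : Set} → (J → Coalg) → Coalg
  ΣCoalg {J} C = record
    { St  = Σ J λ j → St (C j)
    ; out = λ { (j , s) → NegF-map (j ,_) (out (C j) s) } }

  Conjuncts : ∀ {X} → PosF X → Set
  Conjuncts Ω       = ⊥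
  Conjuncts (⋀ I S) = I

  conjunct : ∀ {X} (p : PosF X) → Conjuncts p → PreF X
  conjunct (⋀ I S) i = S i

  allConjuncts : {J : Set} → (J → Pos) → Pos
  allConjuncts {J} X =
    mkPos (ΣCoalg (λ j → coalg (X j)))
          (⋀ (Σ J λ j → Conjuncts (root (X j)))
             (λ { (j , c) → PreF-map (j ,_) (conjunct (root (X j)) c) }))

  -- M is ⋀X  (positive): Ω if Ω ∈ X; otherwise the conjunction of all
  -- conjuncts of members of X (which is ✠ when X = ∅).  Stated as a relation
  -- since "Ω ∈ X" is not decidable.
  IsMeetP : {J : Set} → (J → Pos) → Pos → Set₁
  IsMeetP {J} X M =
    ((Σ J λ j → root (X j) ≡ Ω) × root M ≡ Ω) ⊎
    ((∀ j → root (X j) ≢ Ω) × M ≈P allConjuncts X)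

  IsMeetN : {J : Set} → (J → Neg) → Neg → Set₁
  IsMeetN {J} X M =
    Σ ((j : J) → Name → PosF (St (coalgN (X j)))) λ F →
      (∀ j → out (coalgN (X j)) (rootN (X j)) ≡ sum (F j)) ×
    Σ (Name → PosF (St (coalgN M))) λ g →
      (out (coalgN M) (rootN M) ≡ sum g) ×
      (∀ a → IsMeetP (λ j → mkPos (coalgN (X j)) (F j a)) (mkPos (coalgN M) (g a)))

module Submission where

-- All three claims follow from one coinductive preorder ⊑ on
-- designs, the *simulation* order: P ⊑ Q when there is a relation on
-- negative subdesigns such that every conjunct of Q is matched by a related
-- conjunct of P, and related negatives have the same shape (same variable,
-- or sums whose components are again related in this way).  It is the
-- coinductive closure of the order ≤ of the paper (Ω is below everything).

open import Defs
open import Data.Product using (Σ; ∃; _×_; _,_; proj₁; proj₂)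
open import Data.Sum using (_⊎_; inj₁; inj₂)
open import Data.Nat using (ℕ; zero; suc; _+_)
open import Data.Fin using (Fin)
import Data.Fin as Fin
open import Data.Unit using (⊤; tt)
open import Data.Empty using (⊥; ⊥-elim)
open import Relation.Nullary using (¬_)
open import Relation.Binary.PropositionalEquality using (_≡_; _≢_; refl; sym; trans; cong; subst; subst₂)
open import Relation.Binary.Construct.Closure.ReflexiveTransitive using (ε; _◅_; _◅◅_)

module Simulation (Sig : Signature) where
  open Designs Sig

  PosSim : {X Y : Set} (R : X → Y → Set) → PosF X → PosF Y → Set
  PosSim R Ω       _       = ⊤
  PosSim R (⋀ _ _) Ω       = ⊥
  PosSim R (⋀ I S) (⋀ J T) = ∀ j → ∃ λ i → PreRel R (S i) (T j)

  NegSim : {X Y : Set} (R : X → Y → Set) → NegF X → NegF Y → Set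
  NegSim R (var x) (var y) = x ≡ y
  NegSim R (var _) (sum _) = ⊥
  NegSim R (sum _) (var _) = ⊥
  NegSim R (sum f) (sum g) = ∀ a → PosSim R (f a) (g a)

  IsSimulation : (C D : Coalg) → (St C → St D → Set) → Set
  IsSimulation C D R = ∀ x y → R x y → NegSim R (out C x) (out D y)

  _⊑P_ : Pos → Pos → Set₁
  P ⊑P Q = Σ (St (coalg P) → St (coalg Q) → Set) λ R →
             IsSimulation (coalg P) (coalg Q) R × PosSim R (root P) (root Q)

  _⊑N_ : Neg → Neg → Set₁
  N ⊑N M = Σ (St (coalgN N) → St (coalgN M) → Set) λ R →
             IsSimulation (coalgN N) (coalgN M) R × R (rootN N) (rootN M)

  PreRel-map : ∀ {X Y X′ Y′ : Set} {R : X → Y → Set} {R′ : X′ → Y′ → Set}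
    (h : X → X′) (h′ : Y → Y′) → (∀ {x y} → R x y → R′ (h x) (h′ y)) →
    ∀ {s t} → PreRel R s t → PreRel R′ (PreF-map h s) (PreF-map h′ t)
  PreRel-map h h′ hr (pre-rel r rs) = pre-rel (hr r) (λ k → hr (rs k))

  PosSim-map : ∀ {X Y X′ Y′ : Set} {R : X → Y → Set} {R′ : X′ → Y′ → Set}
    (h : X → X′) (h′ : Y → Y′) → (∀ {x y} → R x y → R′ (h x) (h′ y)) →
    ∀ p q → PosSim R p q → PosSim R′ (PosF-map h p) (PosF-map h′ q)
  PosSim-map h h′ hr Ω       q       _  = tt
  PosSim-map h h′ hr (⋀ I S) (⋀ J T) le j = proj₁ (le j) , PreRel-map h h′ hr (proj₂ (le j))

  NegSim-map : ∀ {X Y X′ Y′ : Set} {R : X → Y → Set} {R′ : X′ → Y′ → Set}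
    (h : X → X′) (h′ : Y → Y′) → (∀ {x y} → R x y → R′ (h x) (h′ y)) →
    ∀ a b → NegSim R a b → NegSim R′ (NegF-map h a) (NegF-map h′ b)
  NegSim-map h h′ hr (var x) (var y) e  = e
  NegSim-map h h′ hr (sum f) (sum g) le a = PosSim-map h h′ hr (f a) (g a) (le a)

  PreRel-mono : ∀ {X Y : Set} {R R′ : X → Y → Set} → (∀ {x y} → R x y → R′ x y) →
    ∀ {s t} → PreRel R s t → PreRel R′ s t
  PreRel-mono hr (pre-rel r rs) = pre-rel (hr r) (λ k → hr (rs k))

  PosSim-mono : ∀ {X Y : Set} {R R′ : X → Y → Set} → (∀ {x y} → R x y → R′ x y) →
    ∀ p q → PosSim R p q → PosSim R′ p q
  PosSim-mono hr Ω       q       _  = tt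
  PosSim-mono hr (⋀ I S) (⋀ J T) le j = proj₁ (le j) , PreRel-mono hr (proj₂ (le j))

  NegSim-mono : ∀ {X Y : Set} {R R′ : X → Y → Set} → (∀ {x y} → R x y → R′ x y) →
    ∀ a b → NegSim R a b → NegSim R′ a b
  NegSim-mono hr (var x) (var y) e  = e
  NegSim-mono hr (sum f) (sum g) le a = PosSim-mono hr (f a) (g a) (le a)

  PosSim-refl : ∀ {X : Set} (p : PosF X) → PosSim _≡_ p p
  PosSim-refl Ω       = tt
  PosSim-refl (⋀ I S) j = j , pre-rel refl (λ k → refl)

  NegSim-refl : ∀ {X : Set} (a : NegF X) → NegSim _≡_ a a
  NegSim-refl (var x) = refl
  NegSim-refl (sum f) a = PosSim-refl (f a)

  ⊑P-refl : ∀ P → P ⊑P P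
  ⊑P-refl P = _≡_ , (λ { x .x refl → NegSim-refl (out (coalg P) x) }) , PosSim-refl (root P)

  ⊑N-refl : ∀ N → N ⊑N N
  ⊑N-refl N = _≡_ , (λ { x .x refl → NegSim-refl (out (coalgN N) x) }) , refl

  _⨾_ : ∀ {X Y Z : Set} → (X → Y → Set) → (Y → Z → Set) → X → Z → Set
  _⨾_ {Y = Y} R S x z = Σ Y λ y → R x y × S y z

  PreRel-⨾ : ∀ {X Y Z : Set} {R : X → Y → Set} {S : Y → Z → Set} {s t u} →
    PreRel R s t → PreRel S t u → PreRel (R ⨾ S) s u
  PreRel-⨾ (pre-rel r rs) (pre-rel r′ rs′) = pre-rel (_ , r , r′) (λ k → _ , rs k , rs′ k)

  PosSim-⨾ : ∀ {X Y Z : Set} {R : X → Y → Set} {S : Y → Z → Set} p q u →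
    PosSim R p q → PosSim S q u → PosSim (R ⨾ S) p u
  PosSim-⨾ Ω       q       u       _  _  = tt
  PosSim-⨾ (⋀ I S) (⋀ J T) (⋀ K U) l₁ l₂ k with l₂ k
  ... | j , rel₂ with l₁ j
  ...   | i , rel₁ = i , PreRel-⨾ rel₁ rel₂

  NegSim-⨾ : ∀ {X Y Z : Set} {R : X → Y → Set} {S : Y → Z → Set} a b c →
    NegSim R a b → NegSim S b c → NegSim (R ⨾ S) a c
  NegSim-⨾ (var x) (var y) (var z) e₁ e₂ = trans e₁ e₂
  NegSim-⨾ (sum f) (sum g) (sum h) l₁ l₂ a = PosSim-⨾ (f a) (g a) (h a) (l₁ a) (l₂ a)

  ⊑P-trans : ∀ P Q T → P ⊑P Q → Q ⊑P T → P ⊑P T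
  ⊑P-trans P Q T (R , simR , rootR) (S , simS , rootS) =
    R ⨾ S ,
    (λ { x z (y , r , s) → NegSim-⨾ (out (coalg P) x) (out (coalg Q) y) (out (coalg T) z)
                                     (simR x y r) (simS y z s) }) ,
    PosSim-⨾ (root P) (root Q) (root T) rootR rootS

  _ᵒ : ∀ {X Y : Set} → (X → Y → Set) → Y → X → Set
  (R ᵒ) y x = R x y

  PreRel-converse : ∀ {X Y : Set} {R : X → Y → Set} {s t} → PreRel R s t → PreRel (R ᵒ) t s
  PreRel-converse (pre-rel r rs) = pre-rel r rs

  PosRel⇒PosSim : ∀ {X Y : Set} {R : X → Y → Set} p q → PosRel R p q → PosSim R p q
  PosRel⇒PosSim Ω       Ω       _       = tt
  PosRel⇒PosSim (⋀ I S) (⋀ J T) (_ , b) = b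

  PosRel⇒PosSimᵒ : ∀ {X Y : Set} {R : X → Y → Set} p q → PosRel R p q → PosSim (R ᵒ) q p
  PosRel⇒PosSimᵒ Ω       Ω       _       = tt
  PosRel⇒PosSimᵒ (⋀ I S) (⋀ J T) (f , _) i = proj₁ (f i) , PreRel-converse (proj₂ (f i))

  NegRel⇒NegSim : ∀ {X Y : Set} {R : X → Y → Set} a b → NegRel R a b → NegSim R a b
  NegRel⇒NegSim (var x) (var y) e = e
  NegRel⇒NegSim (sum f) (sum g) r a = PosRel⇒PosSim (f a) (g a) (r a)

  NegRel⇒NegSimᵒ : ∀ {X Y : Set} {R : X → Y → Set} a b → NegRel R a b → NegSim (R ᵒ) b a
  NegRel⇒NegSimᵒ (var x) (var y) e = sym e
  NegRel⇒NegSimᵒ (sum f) (sum g) r a = PosRel⇒PosSimᵒ (f a) (g a) (r a)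

  bisim⇒sim : ∀ {C D R} → IsBisim C D R → IsSimulation C D R
  bisim⇒sim {C} {D} bis x y r = NegRel⇒NegSim (out C x) (out D y) (bis x y r)

  bisim⇒simᵒ : ∀ {C D R} → IsBisim C D R → IsSimulation D C (R ᵒ)
  bisim⇒simᵒ {C} {D} bis y x r = NegRel⇒NegSimᵒ (out C x) (out D y) (bis x y r)

  ≈P⇒⊑P : ∀ P Q → P ≈P Q → P ⊑P Q
  ≈P⇒⊑P P Q (R , bis , r) = R , bisim⇒sim bis , PosRel⇒PosSim (root P) (root Q) r

  ≈P⇒⊒P : ∀ P Q → P ≈P Q → Q ⊑P P
  ≈P⇒⊒P P Q (R , bis , r) = R ᵒ , bisim⇒simᵒ bis , PosRel⇒PosSimᵒ (root P) (root Q) r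

  Ω-⊑P : ∀ P Q → root P ≡ Ω → P ⊑P Q
  Ω-⊑P P Q e = (λ _ _ → ⊥) , (λ _ _ ()) , subst (λ p → PosSim (λ _ _ → ⊥) p (root Q)) (sym e) tt

  ≤P⇒⊑P : ∀ P Q → P ≤P Q → P ⊑P Q
  ≤P⇒⊑P P Q (inj₁ e) = Ω-⊑P P Q e
  ≤P⇒⊑P P Q (inj₂ (I , S , eP , J , T , eQ , R , bis , f)) =
    R , bisim⇒sim bis , subst₂ (PosSim R) (sym eP) (sym eQ) f

  module SubstitutionMonotone (C D : Coalg) (R : St C → St D → Set) (simR : IsSimulation C D R) where
    data SR : SubSt (St C) → SubSt (St D) → Set where
      sub-r   : ∀ {x y} k → R x y → SR (sub x k) (sub y k)
      shift-r : ∀ {x y} m k → R x y → SR (shift x m k) (shift y m k)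

    shift-sim : ∀ x y m k → R x y → NegSim SR (outShift C x m k) (outShift D y m k)
    shift-sim x y m k r with out C x | out D y | simR x y r
    ... | var a | var .a | refl = refl
    ... | sum f | sum g | le   = λ a → PosSim-map _ _ (shift-r (ar a + m) k) (f a) (g a) (le a)

    data ExtRel : St C ⊎ ℕ → St D ⊎ ℕ → Set where
      substituted : ∀ {s t} → R s t → ExtRel (inj₁ s) (inj₁ t)
      remaining   : ∀ j → ExtRel (inj₂ j) (inj₂ j)

    ext-rel : ∀ n (σ : Fin n → St C) (τ : Fin n → St D) → (∀ i → R (σ i) (τ i)) →
              ∀ j → ExtRel (ext n σ j) (ext n τ j)
    ext-rel zero    σ τ στ j       = remaining j
    ext-rel (suc n) σ τ στ zero    = substituted (στ Fin.zero)
    ext-rel (suc n) σ τ στ (suc j) = ext-rel n _ _ (λ i → στ (Fin.suc i)) j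

    module _ (n : ℕ) (σ : Fin n → St C) (τ : Fin n → St D) (στ : ∀ i → R (σ i) (τ i)) where
      sub-sim : ∀ x y k → R x y → NegSim SR (outSub C n σ x k) (outSub D n τ y k)
      sub-sim x y k r with out C x | out D y | simR x y r
      ... | sum f | sum g | le = λ a → PosSim-map _ _ (sub-r (ar a + k)) (f a) (g a) (le a)
      ... | var a | var .a | refl with bnd k a
      ...   | inj₁ z = refl
      ...   | inj₂ j with ext n σ j | ext n τ j | ext-rel n σ τ στ j
      ...     | inj₁ s  | inj₁ t   | substituted r′ = shift-sim s t zero k r′
      ...     | inj₂ j′ | inj₂ .j′ | remaining .j′  = refl

      SR-simulation : IsSimulation (substC C n σ) (substC D n τ) SR
      SR-simulation .(sub x k)     .(sub y k)     (sub-r {x} {y} k r)     = sub-sim x y k r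
      SR-simulation .(shift x m k) .(shift y m k) (shift-r {x} {y} m k r) = shift-sim x y m k r

      substPos-mono : ∀ p q → PosSim R p q → substPos C n σ p ⊑P substPos D n τ q
      substPos-mono p q le = SR , SR-simulation , PosSim-map _ _ (sub-r zero) p q le

  data _⊎ᴿ_ {A₁ B₁ A₂ B₂ : Set} (R₁ : A₁ → B₁ → Set) (R₂ : A₂ → B₂ → Set) :
              A₁ ⊎ A₂ → B₁ ⊎ B₂ → Set where
    left  : ∀ {x y} → R₁ x y → (R₁ ⊎ᴿ R₂) (inj₁ x) (inj₁ y)
    right : ∀ {x y} → R₂ x y → (R₁ ⊎ᴿ R₂) (inj₂ x) (inj₂ y)

  ⊕-simulation : ∀ {C₁ D₁ C₂ D₂} {R₁ : St C₁ → St D₁ → Set} {R₂ : St C₂ → St D₂ → Set} →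
    IsSimulation C₁ D₁ R₁ → IsSimulation C₂ D₂ R₂ → IsSimulation (C₁ ⊕ C₂) (D₁ ⊕ D₂) (R₁ ⊎ᴿ R₂)
  ⊕-simulation {C₁} {D₁} sim₁ sim₂ .(inj₁ x) .(inj₁ y) (left {x} {y} r) =
    NegSim-map inj₁ inj₁ left (out C₁ x) (out D₁ y) (sim₁ x y r)
  ⊕-simulation {C₂ = C₂} {D₂ = D₂} sim₁ sim₂ .(inj₂ x) .(inj₂ y) (right {x} {y} r) =
    NegSim-map inj₂ inj₂ right (out C₂ x) (out D₂ y) (sim₂ x y r)

  [/x₀]-mono : ∀ P Q N M → P ⊑P Q → N ⊑N M → (P [ N /x₀]) ⊑P (Q [ M /x₀])
  [/x₀]-mono P Q N M (R₁ , sim₁ , root₁) (R₂ , sim₂ , root₂) =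
    SubstitutionMonotone.substPos-mono
      (coalg P ⊕ coalgN N) (coalg Q ⊕ coalgN M) (R₁ ⊎ᴿ R₂) (⊕-simulation sim₁ sim₂)
      1 (λ _ → inj₂ (rootN N)) (λ _ → inj₂ (rootN M)) (λ _ → right root₂)
      (PosF-map inj₁ (root P)) (PosF-map inj₁ (root Q))
      (PosSim-map inj₁ inj₁ left (root P) (root Q) root₁)

  NegSim-sum : ∀ {X Y : Set} {R : X → Y → Set} (a : NegF X) {g : Name → PosF Y} →
    NegSim R a (sum g) → Σ (Name → PosF X) λ f → a ≡ sum f
  NegSim-sum (sum f) _ = f , refl

  NegSim-var : ∀ {X Y : Set} {R : X → Y → Set} (a : NegF X) {x} → NegSim R a (var x) → a ≡ var x
  NegSim-var (var y) e = cong var e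

  PosSim-Ω : ∀ {X Y : Set} {R : X → Y → Set} (p : PosF X) → PosSim R p Ω → p ≡ Ω
  PosSim-Ω Ω _ = refl

  PreRel-head : ∀ {X Y : Set} {R : X → Y → Set} {s t} → PreRel R s t → R (head s) (head t)
  PreRel-head (pre-rel r _) = r

  cut-reducts-related : ∀ {C D R} → IsSimulation C D R → ∀ {s t f g} →
    out C (head s) ≡ sum f → out D (head t) ≡ sum g → PreRel R s t →
    substPos C (ar (name s)) (args s) (f (name s)) ⊑P substPos D (ar (name t)) (args t) (g (name t))
  cut-reducts-related {C} {D} {R} simR {f = f} {g} ef eg (pre-rel {n} {m} {a} {Ns} {Ms} r rs) =
    SubstitutionMonotone.substPos-mono C D R simR (ar a) Ns Ms rs (f a) (g a)
      (subst₂ (NegSim R) ef eg (simR n m r) a)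

  -- A non-Ω design mimics each reduction step of a design it simulates:
  -- the conjunct matching the reduced cut is itself a cut on the same name.
  simulate-step : ∀ {P Q Q′} → P ⊑P Q → Q ⇝ Q′ → root P ≢ Ω →
                  Σ Pos λ P′ → (P ⇝ P′) × (P′ ⊑P Q′)
  simulate-step {mkPos C Ω} _ _ P≢Ω = ⊥-elim (P≢Ω refl)
  simulate-step {mkPos C (⋀ I S)} (R , simR , rootR) (step j eg) _ with rootR j
  ... | i , rel
    with NegSim-sum (out C (head (S i)))
           (subst (NegSim R (out C (head (S i)))) eg (simR _ _ (PreRel-head rel)))
  ... | f , ef =
    substPos C (ar (name (S i))) (args (S i)) (f (name (S i))) , step i ef ,
    cut-reducts-related simR ef eg rel

  Shadow : Pos → Pos → Set₁
  Shadow P Q′ = Σ Pos λ P′ → (P ⇝* P′) × (P′ ⊑P Q′)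

  extend-shadow : ∀ {P Q₁ Q₂} → ¬ ReachesΩ P → (sh : Shadow P Q₁) → Q₁ ⇝ Q₂ →
                  Σ (Shadow P Q₂) λ sh′ → proj₁ sh ⇝ proj₁ sh′
  extend-shadow noΩ (P₁ , P⇝*P₁ , P₁⊑Q₁) Q₁⇝Q₂
    with simulate-step P₁⊑Q₁ Q₁⇝Q₂ (λ e → noΩ (P₁ , P⇝*P₁ , e))
  ... | P₂ , P₁⇝P₂ , P₂⊑Q₂ = (P₂ , P⇝*P₁ ◅◅ (P₁⇝P₂ ◅ ε) , P₂⊑Q₂) , P₁⇝P₂

  shadow-steps : ∀ {P Q Q′} → ¬ ReachesΩ P → Shadow P Q → Q ⇝* Q′ → Shadow P Q′
  shadow-steps noΩ sh ε                 = sh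
  shadow-steps noΩ sh (Q⇝Q₁ ◅ Q₁⇝*Q′) = shadow-steps noΩ (proj₁ (extend-shadow noΩ sh Q⇝Q₁)) Q₁⇝*Q′

  head-var-reflected : ∀ P′ Q′ → P′ ⊑P Q′ → HasHeadVarConjunct Q′ →
                       (root P′ ≡ Ω) ⊎ HasHeadVarConjunct P′
  head-var-reflected (mkPos C Ω) _ _ _ = inj₁ refl
  head-var-reflected (mkPos C (⋀ I′ S′)) Q′ (R , simR , rootR) (I , S , eQ , j , x , eh)
    with subst (PosSim R (⋀ I′ S′)) eQ rootR j
  ... | i , rel =
    inj₂ (I′ , S′ , refl , i , x ,
          NegSim-var (out C (head (S′ i)))
            (subst (NegSim R (out C (head (S′ i)))) eh (simR _ _ (PreRel-head rel))))

  ✠-upward-closed : ∀ P Q → P ⊑P Q → NormalFormIs✠ P → NormalFormIs✠ Q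
  ✠-upward-closed P Q P⊑Q (noDiv , noΩ , noHead) = noDivQ , noΩQ , noHeadQ
    where
    start : Shadow P Q
    start = P , ε , P⊑Q

    noΩQ : ¬ ReachesΩ Q
    noΩQ (Q′ , Q⇝*Q′ , e) with shadow-steps noΩ start Q⇝*Q′
    ... | P′ , P⇝*P′ , (R , _ , rootR) =
      noΩ (P′ , P⇝*P′ , PosSim-Ω (root P′) (subst (PosSim R (root P′)) e rootR))

    noHeadQ : ∀ Q′ → Q ⇝* Q′ → ¬ HasHeadVarConjunct Q′
    noHeadQ Q′ Q⇝*Q′ hv with shadow-steps noΩ start Q⇝*Q′
    ... | P′ , P⇝*P′ , P′⊑Q′ with head-var-reflected P′ Q′ P′⊑Q′ hv
    ...   | inj₁ e   = noΩ (P′ , P⇝*P′ , e)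
    ...   | inj₂ hv′ = noHead P′ P⇝*P′ hv′

    -- an infinite reduction sequence of Q is shadowed by one of P
    noDivQ : ¬ Diverges Q
    noDivQ (s , s₀≡Q , s-steps) = noDiv (shadow , refl , shadow-step)
      where
      shadows : ∀ k → Shadow P (s k)
      shadows zero    = P , ε , subst (P ⊑P_) (sym s₀≡Q) P⊑Q
      shadows (suc k) = proj₁ (extend-shadow noΩ (shadows k) (s-steps k))

      shadow : ℕ → Pos
      shadow k = proj₁ (shadows k)

      shadow-step : ∀ k → shadow k ⇝ shadow (suc k)
      shadow-step k = proj₂ (extend-shadow noΩ (shadows k) (s-steps k))

  ⊑P⇒⪯P : ∀ P Q → P ⊑P Q → P ⪯P Q
  ⊑P⇒⪯P P Q P⊑Q N _ P⟂N =
    ✠-upward-closed (P [ N /x₀]) (Q [ N /x₀]) ([/x₀]-mono P Q N N P⊑Q (⊑N-refl N)) P⟂N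

  ⊑N⇒⪯N : ∀ N M → N ⊑N M → N ⪯N M
  ⊑N⇒⪯N N M N⊑M P _ P⟂N =
    ✠-upward-closed (P [ N /x₀]) (P [ M /x₀]) ([/x₀]-mono P P N M (⊑P-refl P) N⊑M) P⟂N

  PosRel-conjunct : ∀ {A B : Set} {R : A → B → Set} (p : PosF A) (q : PosF B) → PosRel R p q →
    (c : Conjuncts p) → Σ (Conjuncts q) λ c′ → PreRel (R ᵒ) (conjunct q c′) (conjunct p c)
  PosRel-conjunct (⋀ I S) (⋀ J T) (f , _) c = proj₁ (f c) , PreRel-converse (proj₂ (f c))

  PosRel-Ω : ∀ {A B : Set} {R : A → B → Set} (q : PosF B) → PosRel R (Ω {A}) q → q ≡ Ω
  PosRel-Ω Ω _ = refl

  -- X ⊆ Y: the conjunction of the conjuncts of Y simulates that of X, using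
  -- on the j-th summand the (converse) bisimulation between X j and the
  -- member of Y it is included as.
  module ConjunctsAntitone {J K : Set} (X : J → Pos) (Y : K → Pos) (X⊆Y : X ⊆P Y) where
    image : J → K
    image j = proj₁ (X⊆Y j)

    bisim : (j : J) → X j ≈P Y (image j)
    bisim j = proj₂ (X⊆Y j)

    data RΣ : St (coalg (allConjuncts Y)) → St (coalg (allConjuncts X)) → Set where
      related : ∀ j {x y} → proj₁ (bisim j) x y → RΣ (image j , y) (j , x)

    RΣ-simulation : IsSimulation (coalg (allConjuncts Y)) (coalg (allConjuncts X)) RΣ
    RΣ-simulation .(image j , y) .(j , x) (related j {x} {y} r) =
      NegSim-map (image j ,_) (j ,_) (related j) (out (coalg (Y (image j))) y) (out (coalg (X j)) x)
        (bisim⇒simᵒ (proj₁ (proj₂ (bisim j))) y x r)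

    allConjuncts-antitone : allConjuncts Y ⊑P allConjuncts X
    allConjuncts-antitone = RΣ , RΣ-simulation , λ { (j , c) →
      let (c′ , rel) = PosRel-conjunct (root (X j)) (root (Y (image j))) (proj₂ (proj₂ (bisim j))) c
      in (image j , c′) , PreRel-map (image j ,_) (j ,_) (related j) rel }

  -- Positive meets are antitone: X ⊆ Y gives ⋀Y ⊑ ⋀X.  If Ω ∈ Y then ⋀Y = Ω;
  -- Ω ∈ X would force Ω ∈ Y; otherwise compare the conjunctions of conjuncts.
  meetP-antitone : ∀ {J K : Set} (X : J → Pos) (Y : K → Pos) → X ⊆P Y →
    ∀ MX MY → IsMeetP X MX → IsMeetP Y MY → MY ⊑P MX
  meetP-antitone X Y X⊆Y MX MY _ (inj₁ (_ , MY≡Ω)) = Ω-⊑P MY MX MY≡Ω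
  meetP-antitone X Y X⊆Y MX MY (inj₁ ((j , Xj≡Ω) , _)) (inj₂ (Y≢Ω , _)) with X⊆Y j
  ... | k , R , _ , rootR =
    ⊥-elim (Y≢Ω k (PosRel-Ω (root (Y k)) (subst (λ p → PosRel R p (root (Y k))) Xj≡Ω rootR)))
  meetP-antitone X Y X⊆Y MX MY (inj₂ (_ , MX≈X)) (inj₂ (_ , MY≈Y)) =
    ⊑P-trans MY (allConjuncts Y) MX (≈P⇒⊑P MY (allConjuncts Y) MY≈Y)
      (⊑P-trans (allConjuncts Y) (allConjuncts X) MX
        (ConjunctsAntitone.allConjuncts-antitone X Y X⊆Y) (≈P⇒⊒P MX (allConjuncts X) MX≈X))

  -- Negative meets are antitone: componentwise this is the positive case,
  -- and the simulations of the components together with the pair of roots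
  -- form a simulation ⋀Y ⊑ ⋀X.
  meetN-antitone : ∀ {J K : Set} (X : J → Neg) (Y : K → Neg) → X ⊆N Y →
    ∀ MX MY → IsMeetN X MX → IsMeetN Y MY → MY ⊑N MX
  meetN-antitone X Y X⊆Y MX MY (FX , eFX , gX , egX , meetX) (FY , eFY , gY , egY , meetY) =
    U , U-simulation , inj₁ (refl , refl)
    where
    component-⊆ : ∀ a → (λ j → mkPos (coalgN (X j)) (FX j a)) ⊆P (λ k → mkPos (coalgN (Y k)) (FY k a))
    component-⊆ a j with X⊆Y j
    ... | k , R , bis , r = k , R , bis , subst₂ (NegRel R) (eFX j) (eFY k) (bis _ _ r) a

    component-⊑ : ∀ a → mkPos (coalgN MY) (gY a) ⊑P mkPos (coalgN MX) (gX a)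
    component-⊑ a = meetP-antitone _ _ (component-⊆ a)
                      (mkPos (coalgN MX) (gX a)) (mkPos (coalgN MY) (gY a)) (meetX a) (meetY a)

    U : St (coalgN MY) → St (coalgN MX) → Set
    U s t = ((s ≡ rootN MY) × (t ≡ rootN MX)) ⊎ Σ Name λ a → proj₁ (component-⊑ a) s t

    U-simulation : IsSimulation (coalgN MY) (coalgN MX) U
    U-simulation s t (inj₁ (refl , refl)) =
      subst₂ (NegSim U) (sym egY) (sym egX)
        (λ a → PosSim-mono (λ r → inj₂ (a , r)) (gY a) (gX a) (proj₂ (proj₂ (component-⊑ a))))
    U-simulation s t (inj₂ (a , r)) =
      NegSim-mono (λ r′ → inj₂ (a , r′)) (out (coalgN MY) s) (out (coalgN MX) t)
        (proj₁ (proj₂ (component-⊑ a)) s t r)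

  ⪯P-refl : ∀ P → P ⪯P P
  ⪯P-refl P N _ P⟂N = P⟂N

  ⪯P-trans : ∀ P Q R → P ⪯P Q → Q ⪯P R → P ⪯P R
  ⪯P-trans P Q R P⪯Q Q⪯R N atN P⟂N = Q⪯R N atN (P⪯Q N atN P⟂N)

  ⪯N-refl : ∀ N → N ⪯N N
  ⪯N-refl N P _ P⟂N = P⟂N

  ⪯N-trans : ∀ N M L → N ⪯N M → M ⪯N L → N ⪯N L
  ⪯N-trans N M L N⪯M M⪯L P atP P⟂N = M⪯L P atP (N⪯M P atP P⟂N)

-- Proposition 2.3.
proposition2p3 :
    (Sig : Signature) → let open Designs Sig in
      ((∀ P → AtomicP P → P ⪯P P) ×
       (∀ P Q R → AtomicP P → AtomicP Q → AtomicP R → P ⪯P Q → Q ⪯P R → P ⪯P R) ×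
       (∀ N → AtomicN N → N ⪯N N) ×
       (∀ N M L → AtomicN N → AtomicN M → AtomicN L → N ⪯N M → M ⪯N L → N ⪯N L))
      ×
      (∀ P Q → AtomicP P → AtomicP Q → P ≤P Q → P ⪯P Q)
      ×
      ((∀ {J K : Set} (X : J → Pos) (Y : K → Pos) →
          (∀ j → AtomicP (X j)) → (∀ k → AtomicP (Y k)) → X ⊆P Y →
          ∀ MX MY → IsMeetP X MX → IsMeetP Y MY → MY ⪯P MX) ×
       (∀ {J K : Set} (X : J → Neg) (Y : K → Neg) →
          (∀ j → AtomicN (X j)) → (∀ k → AtomicN (Y k)) → X ⊆N Y →
          ∀ MX MY → IsMeetN X MX → IsMeetN Y MY → MY ⪯N MX))
proposition2p3 Sig =
  ((λ P _ → ⪯P-refl P) , (λ P Q R _ _ _ → ⪯P-trans P Q R) ,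
   (λ N _ → ⪯N-refl N) , (λ N M L _ _ _ → ⪯N-trans N M L)) ,
  (λ P Q _ _ P≤Q → ⊑P⇒⪯P P Q (≤P⇒⊑P P Q P≤Q)) ,
  ((λ X Y _ _ X⊆Y MX MY meetX meetY → ⊑P⇒⪯P MY MX (meetP-antitone X Y X⊆Y MX MY meetX meetY)) ,
   (λ X Y _ _ X⊆Y MX MY meetX meetY → ⊑N⇒⪯N MY MX (meetN-antitone X Y X⊆Y MX MY meetX meetY)))
  where open Simulation Sig
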